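{- Let $G$ be a connected block graph, $u\in V_{cut}(G)$, $B\in\mathcal{B}_u(G)$, $p\in\{(u,B),(B,u)\}$, and let $C$ be a $p$-independent set of $G$. Then (i) $cap(C)\ge 0$; and (ii) if $ua(p)=$True and $u$ is not under attack in $C$, then $cap(C)>0$.
   Context: All graphs are finite, simple and undirected. A cut-vertex of a graph is a vertex whose removal increases the number of connected components. A block of $G$ is a maximal set $S\subseteq V(G)$ such that $G[S]$ is 2-connected. A block graph is a graph every block of which induces a clique. For a connected block graph $G$: $V_{cut}(G)$ is its set of cut-vertices, $\mathcal{B}_u(G)$ the set of blocks containing $u$, $K_B(G)=B\cap V_{cut}(G)$. For $u\in V_{cut}(G)$, $B\in\mathcal{B}_u(G)$: $G[u,B]$ is the connected component containing $u$ of $G$ minus all edges $uv$ with $v\in B$; $G[B,u]$ is the connected component containing $u$ of $G$ minus all edges $uv$ with $v\notin B$. For $p\in\{(u,B),(B,u)\}$, $u$ is the base of $p$ and $G[p]$ is $G[u,B]$ resp. $G[B,u]$. $\beta(u,B)=\mathcal{B}_u(G[u,B])$, $\kappa(B,u)=K_B(G[B,u])$. For $p$ with base $u$, a $p$-independent set is a subset of $V(G[p])$ independent in $G$; $C^\circ=C\setminus\{u\}$; $S[q]=S\cap V(G[q])$. A vertex $u$ is under attack in $C$ if $N_G(u)\cap C\ne\emptyset$. Depth: $d(B,u)=0$ if $\kappa(B,u)=\emptyset$, else $1+\max_{v\in\kappa(B,u)}d(v,B)$; $d(u,B)=1+\max_{B'\in\beta(u,B)}d(B',u)$. Boolean $ua(p)$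 (True=1, False=0 in arithmetic): $ua(p)=$True if $d(p)=0$; for $d(B,u)>0$, $ua(B,u)$ is False exactly when $ua(v,B)=$True for all $v\in\kappa(B,u)$ and $B=\kappa(B,u)\cup\{u\}$; $ua(u,B)$ is True exactly when $ua(B',u)=$True for some $B'\in\beta(u,B)$. Capacity of a $p$-independent set $C$: for $p=(B,u)$, $cap(C)=\sum_{v\in\kappa(B,u)}cap(C[v,B])+ua(B,u)-|B\cap C^\circ|$; for $p=(u,B)$, $cap(C)=0$ if some $B'\in\beta(u,B)$ has $cap(C[B',u])=0$ and $ua(B',u)=$True, otherwise $cap(C)=\sum_{B'\in\beta(u,B)}(cap(C[B',u])-ua(B',u))+ua(u,B)$. -}

module Defs where

open import Data.Nat using (ℕ)
open import Data.Bool using (Bool; true; false)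
open import Data.Fin using (Fin)
open import Data.Fin.Subset using (Subset; _∈_; _∉_; _∩_; ∣_∣) renaming (_-_ to _∖ˢ_)
open import Data.Integer using (ℤ; +_; _+_; _-_; 0ℤ)
open import Data.List using (List; []; _∷_; map; foldr)
import Data.List.Membership.Propositional as LM
open import Data.List.Relation.Unary.Unique.Propositional using (Unique)
open import Data.Product using (Σ; ∃; _×_; _,_)
open import Data.Sum using (_⊎_)
open import Data.Unit using (⊤)
open import Relation.Binary.PropositionalEquality using (_≡_; _≢_)
open import Relation.Nullary using (¬_)

record Graph (n : ℕ) : Set where
  field
    adj    : Fin n → Fin n → Bool
    sym    : ∀ x y → adj x y ≡ adj y x
    irrefl : ∀ x → adj x x ≡ false

Edge : ∀ {n} → Graph n → Fin n → Fin n → Set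
Edge G x y = Graph.adj G x y ≡ true

-- Generic notions for a "subgraph" given by a vertex predicate V and an
-- edge predicate E (only edges between vertices of V are ever used).

module _ {n : ℕ} where

  VPred : Set₁
  VPred = Fin n → Set

  EPred : Set₁
  EPred = Fin n → Fin n → Set

  data Reach (V : VPred) (E : EPred) : Fin n → Fin n → Set where
    here : ∀ {x} → V x → Reach V E x x
    step : ∀ {x y z} → V x → E x y → Reach V E y z → Reach V E x z

  Connected : VPred → EPred → Set
  Connected V E = ∀ x y → V x → V y → Reach V E x y

  _∖_ : VPred → Fin n → VPred
  (V ∖ v) x = V x × x ≢ v

  -- v is a cut-vertex of (V,E): removing v increases the number of
  -- connected components, i.e. two vertices other than v that are
  -- connected in (V,E) become disconnected in (V,E) - v.
  CutVertex : VPred → EPred → Fin n → Set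
  CutVertex V E v =
    V v × Σ (Fin n) λ x → Σ (Fin n) λ y →
      x ≢ v × y ≢ v × V x × V y × Reach V E x y × ¬ Reach (V ∖ v) E x y

  -- the induced subgraph on S is 2-connected (blocks may be bridges K2):
  -- at least two vertices, connected, and stays connected after removing
  -- any single vertex.
  TwoConnected : VPred → EPred → Set
  TwoConnected S E =
    (Σ (Fin n) λ x → Σ (Fin n) λ y → x ≢ y × S x × S y) ×
    Connected S E × (∀ x → S x → Connected (S ∖ x) E)

  IsBlock : VPred → EPred → Subset n → Set
  IsBlock V E B =
    (∀ x → x ∈ B → V x) × TwoConnected (_∈ B) E ×
    (∀ (T : Subset n) → (∀ x → x ∈ B → x ∈ T) → (∀ x → x ∈ T → V x) →
       TwoConnected (_∈ T) E → ∀ x → x ∈ T → x ∈ B)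


Enum : {A : Set} → (A → Set) → List A → Set
Enum P xs = Unique xs × (∀ x → x LM.∈ xs → P x) × (∀ x → P x → x LM.∈ xs)

sumℤ : List ℤ → ℤ
sumℤ = foldr _+_ 0ℤ

toℤ : Bool → ℤ
toℤ true  = + 1
toℤ false = 0ℤ

module _ {n : ℕ} (G : Graph n) where

  AllV : VPred {n}
  AllV _ = ⊤

  IsConnected : Set
  IsConnected = Connected AllV (Edge G)

  IsCutVertex : Fin n → Set
  IsCutVertex = CutVertex AllV (Edge G)

  IsBlockG : Subset n → Set
  IsBlockG = IsBlock AllV (Edge G)

  IsBlockGraph : Set
  IsBlockGraph = ∀ B → IsBlockG B → ∀ x y → x ∈ B → y ∈ B → x ≢ y → Edge G x y

  data Pair : Set where
    ⟨_,_⟩ᵥ : Fin n → Subset n → Pair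
    ⟨_,_⟩ᵦ : Subset n → Fin n → Pair

  base : Pair → Fin n
  base ⟨ u , _ ⟩ᵥ = u
  base ⟨ _ , u ⟩ᵦ = u

  EP : Pair → EPred {n}
  EP ⟨ u , B ⟩ᵥ x y =
    Edge G x y × ¬ ((x ≡ u × y ∈ B) ⊎ (y ≡ u × x ∈ B))
  EP ⟨ B , u ⟩ᵦ x y =
    Edge G x y × ¬ ((x ≡ u × y ∉ B) ⊎ (y ≡ u × x ∉ B))

  VP : Pair → VPred {n}
  VP p x = Reach AllV (EP p) (base p) x

  Kappa : Subset n → Fin n → Fin n → Set
  Kappa B u v = v ∈ B × CutVertex (VP ⟨ B , u ⟩ᵦ) (EP ⟨ B , u ⟩ᵦ) v

  Beta : Fin n → Subset n → Subset n → Set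
  Beta u B B' = IsBlock (VP ⟨ u , B ⟩ᵥ) (EP ⟨ u , B ⟩ᵥ) B' × u ∈ B'

  PIndep : Pair → Subset n → Set
  PIndep p C = (∀ x → x ∈ C → VP p x) ×
               (∀ x y → x ∈ C → y ∈ C → ¬ Edge G x y)

  Restr : Subset n → Pair → Subset n → Set
  Restr C q D = ∀ x → (x ∈ D → x ∈ C × VP q x) × (x ∈ C × VP q x → x ∈ D)

  UnderAttack : Fin n → Subset n → Set
  UnderAttack u C = Σ (Fin n) λ w → w ∈ C × Edge G u w

  BIsKappaU : Subset n → Fin n → Set
  BIsKappaU B u = ∀ x → (x ∈ B → Kappa B u x ⊎ x ≡ u) × (Kappa B u x ⊎ x ≡ u → x ∈ B)

  -- ua(p) as a relation  UA p b  ("ua(p) = b").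
  -- d(B,u) = 0 iff κ(B,u) = ∅, and d(u,B) ≥ 1 always.
  data UA : Pair → Bool → Set where
    bu-leaf  : ∀ {B u} → (∀ v → ¬ Kappa B u v) → UA ⟨ B , u ⟩ᵦ true
    bu-false : ∀ {B u} → (∃ λ v → Kappa B u v) →
               (∀ v → Kappa B u v → UA ⟨ v , B ⟩ᵥ true) →
               BIsKappaU B u → UA ⟨ B , u ⟩ᵦ false
    bu-true₁ : ∀ {B u} → (∃ λ v → Kappa B u v) →
               (Σ (Fin n) λ v → Kappa B u v × UA ⟨ v , B ⟩ᵥ false) →
               UA ⟨ B , u ⟩ᵦ true
    bu-true₂ : ∀ {B u} → (∃ λ v → Kappa B u v) →
               ¬ BIsKappaU B u → UA ⟨ B , u ⟩ᵦ true
    ub-true  : ∀ {u B} → (Σ (Subset n) λ B' → Beta u B B' × UA ⟨ B' , u ⟩ᵦ true) →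
               UA ⟨ u , B ⟩ᵥ true
    ub-false : ∀ {u B} → (∀ B' → Beta u B B' → UA ⟨ B' , u ⟩ᵦ false) →
               UA ⟨ u , B ⟩ᵥ false

  data Cap : Pair → Subset n → ℤ → Set where
    cap-bu : ∀ {B u C} (ks : List (Fin n)) → Enum {A = Fin n} (Kappa B u) ks →
             (f : Fin n → ℤ) →
             (∀ v → v LM.∈ ks →
                Σ (Subset n) λ D → Restr C ⟨ v , B ⟩ᵥ D × Cap ⟨ v , B ⟩ᵥ D (f v)) →
             (b : Bool) → UA ⟨ B , u ⟩ᵦ b →
             Cap ⟨ B , u ⟩ᵦ C (sumℤ (map f ks) + toℤ b - + ∣ B ∩ (C ∖ˢ u) ∣)
    cap-ub-zero : ∀ {u B C} (B' : Subset n) → Beta u B B' →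
             (D : Subset n) → Restr C ⟨ B' , u ⟩ᵦ D →
             Cap ⟨ B' , u ⟩ᵦ D 0ℤ → UA ⟨ B' , u ⟩ᵦ true →
             Cap ⟨ u , B ⟩ᵥ C 0ℤ
    cap-ub-sum : ∀ {u B C} (bs : List (Subset n)) → Enum {A = Subset n} (Beta u B) bs →
             (f : Subset n → ℤ) (g : Subset n → Bool) →
             (∀ B' → B' LM.∈ bs →
                Σ (Subset n) λ D → Restr C ⟨ B' , u ⟩ᵦ D ×
                  Cap ⟨ B' , u ⟩ᵦ D (f B') × UA ⟨ B' , u ⟩ᵦ (g B')) →
             (∀ B' → B' LM.∈ bs → ¬ (f B' ≡ 0ℤ × g B' ≡ true)) →
             (b : Bool) → UA ⟨ u , B ⟩ᵥ b →
             Cap ⟨ u , B ⟩ᵥ C (sumℤ (map (λ B' → f B' - toℤ (g B')) bs) + toℤ b)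

module Submission where

-- Both claims are proved together with the computation of cap and ua, by well-founded
-- recursion on the number of vertices of G[p].  Two facts about a block B of a block graph
-- make the recursion go down: from a ∈ B no other vertex of B is reachable once the edges
-- from a into B are deleted (else B plus a path would be a larger 2-connected set), and u is
-- never in κ(B,u) (a walk through u can shortcut between the two B-neighbours of u).
-- For (B,u), an independent C meets the clique B in at most one vertex w; if w ≠ u exists,
-- then u is under attack and either ua(B,u) holds or w ∈ κ(B,u) contributes positive
-- capacity.  For (u,B), every summand cap − ua is nonnegative unless some child has
-- capacity 0 and ua = True, which is exactly when cap(C) is defined to be 0.

open import Defs
open import Data.Bool using (Bool; true; false)
open import Data.Bool.Properties using (¬-not) renaming (_≟_ to _≟ᵇ_)
open import Data.Empty using (⊥-elim)
open import Data.Fin using (Fin; _≟_)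
open import Data.Fin.Properties using (any?; all?)
open import Data.Fin.Subset
  using (Subset; _∈_; _∉_; _─_; _∩_; _⊆_; ⁅_⁆; ∣_∣; inside; outside; Nonempty)
  renaming (_-_ to _∖ˢ_)
open import Data.Fin.Subset.Properties
  using (x∈p∩q⁺; x∈p∩q⁻; p─q⊆p; x∈p∧x≢y⇒x∈p-y; x∈⁅x⁆; ∣⁅x⁆∣≡1; nonempty?; Empty-unique; ∣⊥∣≡0;
         p⊆q⇒∣p∣≤∣q∣; p⊂q⇒∣p∣<∣q∣; x∈p⇒∣p-x∣<∣p∣; ∣p∣≤n)
import Data.Fin.Subset.Properties as Subset
open import Data.Integer using (ℤ; 0ℤ; +_; _+_; _-_; _≤_; _<_; +≤+; +<+)
import Data.Integer.Properties as ℤ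
open import Data.List using (List; []; _∷_; map; _++_; filter; allFin)
open import Data.List.Membership.Propositional using (find; lose) renaming (_∈_ to _∈ₗ_)
open import Data.List.Membership.Propositional.Properties
  using (∈-map⁺; ∈-map⁻; ∈-++⁺ˡ; ∈-++⁺ʳ; ∈-filter⁺; ∈-filter⁻; ∈-allFin)
open import Data.List.Membership.DecPropositional using () renaming (_∈?_ to ∈ₗ?)
import Data.List.Relation.Unary.All as All
open import Data.List.Relation.Unary.All using ([]; _∷_)
open import Data.List.Relation.Unary.All.Properties using (¬Any⇒All¬; All¬⇒¬Any)
import Data.List.Relation.Unary.Any as Any
open import Data.List.Relation.Unary.Any using (here; there)
open import Data.List.Relation.Unary.AllPairs using ([]; _∷_)
open import Data.List.Relation.Unary.Unique.Propositional using (Unique)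
import Data.List.Relation.Unary.Unique.Propositional.Properties as Unique
open import Data.Nat using (ℕ; zero; suc; z≤n; s≤s; _*_) renaming (_≤_ to _≤ℕ_; _<_ to _<ℕ_)
open import Data.Nat.Induction using (<-wellFounded)
open import Data.Nat.Properties using (<-≤-trans; ≤-<-trans; n≮0; ≤-pred; *-monoʳ-≤; *-suc)
open import Data.Product using (Σ; ∃; _×_; _,_; proj₁; proj₂; uncurry)
open import Data.Sum using (_⊎_; inj₁; inj₂)
import Data.Sum as Sum
open import Data.Unit using (tt)
open import Data.Vec using (tabulate; []; _∷_; here; there)
open import Data.Vec.Properties using (lookup∘tabulate; lookup⇒[]=; []=⇒lookup; ∷-injectiveʳ)
open import Function using (_∘_; _on_)
open import Induction.WellFounded using (WfRec)
import Induction.WellFounded as WF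
open import Level using (0ℓ)
import Relation.Binary.Construct.On as On
open import Relation.Binary.PropositionalEquality using (_≡_; _≢_; refl; sym; trans; cong; subst; subst₂)
open import Relation.Nullary using (¬_; Dec; yes; no; does)
open import Relation.Nullary.Decidable
  using (dec-true; decidable-stable; map′; _×-dec_; _⊎-dec_; _→-dec_; ¬?)
open import Relation.Unary using (Decidable)

private
  variable
    n : ℕ

subsetOf : {P : VPred {n}} → Decidable P → Subset n
subsetOf P? = tabulate (does ∘ P?)

module _ {P : VPred {n}} (P? : Decidable P) where

  ∈-subsetOf⁺ : ∀ {x} → P x → x ∈ subsetOf P?
  ∈-subsetOf⁺ {x} px = lookup⇒[]= x _ (trans (lookup∘tabulate _ x) (dec-true (P? x) px))

  ∈-subsetOf⁻ : ∀ {x} → x ∈ subsetOf P? → P x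
  ∈-subsetOf⁻ {x} x∈ with P? x | trans (sym (lookup∘tabulate (does ∘ P?) x)) ([]=⇒lookup x∈)
  ... | yes px | _ = px
  ... | no _   | ()

x∈p─q⇒x∉q : {x : Fin n} (p q : Subset n) → x ∈ p ─ q → x ∉ q
x∈p─q⇒x∉q (inside ∷ p) (outside ∷ q) here ()
x∈p─q⇒x∉q (_ ∷ p) (_ ∷ q) (there x∈p─q) (there x∈q) = x∈p─q⇒x∉q p q x∈p─q x∈q

x∈p∩q-y⁻ : {x y : Fin n} (p q : Subset n) → x ∈ p ∩ (q ∖ˢ y) → x ∈ p × x ∈ q × x ≢ y
x∈p∩q-y⁻ {y = y} p q x∈ =
  let (x∈p , x∈q-y) = x∈p∩q⁻ p (q ∖ˢ y) x∈ in
  x∈p , p─q⊆p q ⁅ y ⁆ x∈q-y , λ { refl → x∈p─q⇒x∉q q ⁅ y ⁆ x∈q-y (x∈⁅x⁆ y) }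

∣p∣≤1 : {p : Subset n} {w : Fin n} → (∀ {x} → x ∈ p → x ≡ w) → ∣ p ∣ ≤ℕ 1
∣p∣≤1 {w = w} p⊆w =
  subst (_ ≤ℕ_) (∣⁅x⁆∣≡1 w) (p⊆q⇒∣p∣≤∣q∣ λ x∈p → subst (_∈ ⁅ w ⁆) (sym (p⊆w x∈p)) (x∈⁅x⁆ w))

∣p∣≡0 : {p : Subset n} → ¬ Nonempty p → ∣ p ∣ ≡ 0
∣p∣≡0 {n} empty = trans (cong ∣_∣ (Empty-unique empty)) (∣⊥∣≡0 n)

subsets : ∀ n → List (Subset n)
subsets zero    = [] ∷ []
subsets (suc n) = map (inside ∷_) (subsets n) ++ map (outside ∷_) (subsets n)

∈-subsets : (p : Subset n) → p ∈ₗ subsets n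
∈-subsets []                  = here refl
∈-subsets (true  ∷ p)         = ∈-++⁺ˡ (∈-map⁺ (inside ∷_) (∈-subsets p))
∈-subsets {suc n} (false ∷ p) = ∈-++⁺ʳ (map (inside ∷_) (subsets n)) (∈-map⁺ (outside ∷_) (∈-subsets p))

subsets-unique : ∀ n → Unique (subsets n)
subsets-unique zero    = [] ∷ []
subsets-unique (suc n) =
  Unique.++⁺ (Unique.map⁺ ∷-injectiveʳ (subsets-unique n)) (Unique.map⁺ ∷-injectiveʳ (subsets-unique n))
             disjoint
  where
  disjoint : ∀ {p} → ¬ (p ∈ₗ map (inside ∷_) (subsets n) × p ∈ₗ map (outside ∷_) (subsets n))
  disjoint (∈ins , ∈outs) with ∈-map⁻ (inside ∷_) ∈ins | ∈-map⁻ (outside ∷_) ∈outs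
  ... | _ , _ , refl | _ , _ , ()

allSubsets? : {P : Subset n → Set} → Decidable P → Dec (∀ T → P T)
allSubsets? {n} P? =
  map′ (λ all T → All.lookup all (∈-subsets T)) (λ all → All.tabulate λ {T} _ → all T)
       (All.all? P? (subsets n))

enumerate : {A : Set} {P : A → Set} (xs : List A) → Unique xs → (∀ x → x ∈ₗ xs) →
            Decidable P → Σ (List A) (Enum P)
enumerate xs unique complete P? =
  filter P? xs , Unique.filter⁺ P? {xs} unique ,
  (λ x x∈ → proj₂ (∈-filter⁻ P? {xs = xs} x∈)) , (λ x px → ∈-filter⁺ P? (complete x) px)

enumerate-Fin : {P : VPred {n}} → Decidable P → Σ (List (Fin n)) (Enum P)
enumerate-Fin {n} = enumerate (allFin n) (Unique.allFin⁺ n) ∈-allFin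

enumerate-Subset : {P : Subset n → Set} → Decidable P → Σ (List (Subset n)) (Enum P)
enumerate-Subset {n} = enumerate (subsets n) (subsets-unique n) ∈-subsets

-- Walks

module _ {V : VPred {n}} {E : EPred {n}} where

  Reach-source : ∀ {x y} → Reach V E x y → V x
  Reach-source (here vx)     = vx
  Reach-source (step vx _ _) = vx

  Reach-snoc : ∀ {x y z} → Reach V E x y → E y z → V z → Reach V E x z
  Reach-snoc (here vy)     e vz = step vy e (here vz)
  Reach-snoc (step vx e r) f vz = step vx e (Reach-snoc r f vz)

  Reach-trans : ∀ {x y z} → Reach V E x y → Reach V E y z → Reach V E x z
  Reach-trans (here _)      s = s
  Reach-trans (step vx e r) s = step vx e (Reach-trans r s)

  Reach-reverse : (∀ {x y} → E x y → E y x) → ∀ {x y} → Reach V E x y → Reach V E y x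
  Reach-reverse E-sym (here vx)     = here vx
  Reach-reverse E-sym (step vx e r) = Reach-snoc (Reach-reverse E-sym r) (E-sym e) vx

  Reach-mapFrom : ∀ {E′ : EPred {n}} {a x} → (∀ {w w′} → Reach V E a w → E w w′ → E′ w w′) →
                  Reach V E a x → Reach V E′ a x
  Reach-mapFrom {E′} {a} f r = go (here (Reach-source r)) r
    where
    go : ∀ {w x} → Reach V E a w → Reach V E w x → Reach V E′ w x
    go _   (here vw)      = here vw
    go a↝w (step vw e r′) = step vw (f a↝w e) (go (Reach-snoc a↝w e (Reach-source r′)) r′)

  Reach-avoid : ∀ {w x y} → Reach V E w y → y ≢ x →
                Reach (V ∖ x) E w y ⊎ ∃ λ x′ → E x x′ × Reach (V ∖ x) E x′ y
  Reach-avoid (here vy) y≢x = inj₁ (here (vy , y≢x))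
  Reach-avoid {x = x} (step {x = w} vw e r) y≢x with Reach-avoid r y≢x | w ≟ x
  ... | inj₂ exit | _        = inj₂ exit
  ... | inj₁ r′   | yes refl = inj₂ (_ , e , r′)
  ... | inj₁ r′   | no w≢x   = inj₁ (step (vw , w≢x) e r′)

  Reach-lastExit : ∀ {x y} → Reach V E x y → x ≢ y → ∃ λ x′ → E x x′ × Reach (V ∖ x) E x′ y
  Reach-lastExit (here _)     x≢x = ⊥-elim (x≢x refl)
  Reach-lastExit (step _ e r) x≢y with Reach-avoid r (x≢y ∘ sym)
  ... | inj₁ r′   = _ , e , r′
  ... | inj₂ exit = exit

Reach-map : ∀ {V V′ : VPred {n}} {E E′ : EPred {n}} → (∀ {x} → V x → V′ x) →
            (∀ {x y} → V x → V y → E x y → E′ x y) → ∀ {x y} → Reach V E x y → Reach V′ E′ x y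
Reach-map f g (here vx)     = here (f vx)
Reach-map f g (step vx e r) = step (f vx) (g vx (Reach-source r) e) (Reach-map f g r)

Reach-∖⁻ : ∀ {V : VPred {n}} {E : EPred {n}} {z x y} → Reach (V ∖ z) E x y → Reach V E x y
Reach-∖⁻ = Reach-map proj₁ (λ _ _ e → e)

∖? : {V : VPred {n}} → Decidable V → ∀ v → Decidable (V ∖ v)
∖? V? v x = V? x ×-dec ¬? (x ≟ v)

module _ {E : EPred {n}} (E? : ∀ x y → Dec (E x y)) where

  Reach?-bounded : ∀ k {V : VPred {n}} (V? : Decidable V) → ∣ subsetOf V? ∣ ≤ℕ k →
                   ∀ x y → Dec (Reach V E x y)
  Reach?-bounded zero V? size≤0 x y =
    no λ r → n≮0 (<-≤-trans (x∈p⇒∣p-x∣<∣p∣ (∈-subsetOf⁺ V? (Reach-source r))) size≤0)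
  Reach?-bounded (suc k) {V} V? size≤k x y with V? x | x ≟ y
  ... | no ¬vx | _        = no (¬vx ∘ Reach-source)
  ... | yes vx | yes refl = yes (here vx)
  ... | yes vx | no x≢y   =
    map′ (λ (x′ , e , r) → step vx e (Reach-∖⁻ r)) (λ r → Reach-lastExit r x≢y)
         (any? λ x′ → E? x x′ ×-dec Reach?-bounded k (∖? V? x) smaller x′ y)
    where
    shrink : subsetOf (∖? V? x) ⊆ subsetOf V? ∖ˢ x
    shrink x′∈ = let (vx′ , x′≢x) = ∈-subsetOf⁻ (∖? V? x) x′∈ in
                 x∈p∧x≢y⇒x∈p-y (∈-subsetOf⁺ V? vx′) x′≢x
    smaller : ∣ subsetOf (∖? V? x) ∣ ≤ℕ k
    smaller = ≤-pred (≤-<-trans (p⊆q⇒∣p∣≤∣q∣ shrink)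
                                (<-≤-trans (x∈p⇒∣p-x∣<∣p∣ (∈-subsetOf⁺ V? vx)) size≤k))

  Reach? : {V : VPred {n}} → Decidable V → ∀ x y → Dec (Reach V E x y)
  Reach? V? = Reach?-bounded _ V? (∣p∣≤n (subsetOf V?))

module _ {V : VPred {n}} {E : EPred {n}} where

  vertices : ∀ {x y} → Reach V E x y → List (Fin n)
  vertices {x} (here _)     = x ∷ []
  vertices {x} (step _ _ r) = x ∷ vertices r

  Simple : ∀ {x y} → Reach V E x y → Set
  Simple r = Unique (vertices r)

  source∈vertices : ∀ {x y} (r : Reach V E x y) → x ∈ₗ vertices r
  source∈vertices (here _)     = here refl
  source∈vertices (step _ _ _) = here refl

  simple-suffix : ∀ {s x y} (r : Reach V E s y) → Simple r → x ∈ₗ vertices r →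
                  Σ (Reach V E x y) Simple
  simple-suffix r@(here _)     simple       (here refl) = r , simple
  simple-suffix r@(step _ _ _) simple       (here refl) = r , simple
  simple-suffix (step _ _ r)   (_ ∷ simple) (there x∈)  = simple-suffix r simple x∈

  eraseLoops : ∀ {x y} → Reach V E x y → Σ (Reach V E x y) Simple
  eraseLoops (here vx) = here vx , [] ∷ []
  eraseLoops {x} (step vx e r) with eraseLoops r
  ... | r′ , simple with ∈ₗ? _≟_ x (vertices r′)
  ...   | yes x∈ = simple-suffix r′ simple x∈
  ...   | no x∉  = step vx e r′ , ¬Any⇒All¬ (vertices r′) x∉ ∷ simple

  private
    onTail : ∀ {s xs z a b} → Reach ((_∈ₗ xs) ∖ z) E a b → Reach ((_∈ₗ s ∷ xs) ∖ z) E a b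
    onTail = Reach-map (λ (a∈ , a≢z) → there a∈ , a≢z) (λ _ _ e → e)

  suffix-avoiding : ∀ {s x y z} (r : Reach V E s y) → ¬ z ∈ₗ vertices r → x ∈ₗ vertices r →
                    Reach ((_∈ₗ vertices r) ∖ z) E x y
  suffix-avoiding (here _)     z∉ (here refl) = here (here refl , z∉ ∘ here ∘ sym)
  suffix-avoiding (step _ e r) z∉ (here refl) =
    step (here refl , z∉ ∘ here ∘ sym) e (onTail (suffix-avoiding r (z∉ ∘ there) (source∈vertices r)))
  suffix-avoiding (step _ e r) z∉ (there x∈)  = onTail (suffix-avoiding r (z∉ ∘ there) x∈)

  simple-split : ∀ {s x y z} (r : Reach V E s y) → Simple r → x ∈ₗ vertices r → x ≢ z →
                 Reach ((_∈ₗ vertices r) ∖ z) E x y ⊎ Reach ((_∈ₗ vertices r) ∖ z) E s x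
  simple-split (here _) _ (here refl) x≢z = inj₁ (here (here refl , x≢z))
  simple-split {z = z} (step _ e r) _ (here refl) x≢z with ∈ₗ? _≟_ z (vertices r)
  ... | yes _ = inj₂ (here (here refl , x≢z))
  ... | no z∉ = inj₁ (step (here refl , x≢z) e (onTail (suffix-avoiding r z∉ (source∈vertices r))))
  simple-split {s} {z = z} (step _ e r) (s∉ ∷ simple) (there x∈) x≢z with s ≟ z
  ... | yes refl = inj₁ (onTail (suffix-avoiding r (All¬⇒¬Any s∉) x∈))
  ... | no s≢z   = Sum.map onTail (step (here refl , s≢z) e ∘ onTail) (simple-split r simple x∈ x≢z)

-- Connectivity

module _ {E : EPred {n}} (E? : ∀ x y → Dec (E x y)) where

  CutVertex? : {V : VPred {n}} → Decidable V → Decidable (CutVertex V E)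
  CutVertex? V? v = V? v ×-dec any? λ x → any? λ y →
    ¬? (x ≟ v) ×-dec ¬? (y ≟ v) ×-dec V? x ×-dec V? y ×-dec
    Reach? E? V? x y ×-dec ¬? (Reach? E? (∖? V? v) x y)

  Connected? : {S : VPred {n}} → Decidable S → Dec (Connected S E)
  Connected? S? = all? λ x → all? λ y → S? x →-dec (S? y →-dec Reach? E? S? x y)

  TwoConnected? : {S : VPred {n}} → Decidable S → Dec (TwoConnected S E)
  TwoConnected? S? =
    (any? λ x → any? λ y → ¬? (x ≟ y) ×-dec S? x ×-dec S? y) ×-dec
    Connected? S? ×-dec (all? λ x → S? x →-dec Connected? (∖? S? x))

  IsBlock? : {V : VPred {n}} → Decidable V → Decidable (IsBlock V E)
  IsBlock? V? B =
    (all? λ x → x Subset.∈? B →-dec V? x) ×-dec TwoConnected? (Subset._∈? B) ×-dec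
    allSubsets? λ T → (all? λ x → x Subset.∈? B →-dec x Subset.∈? T) →-dec
                      ((all? λ x → x Subset.∈? T →-dec V? x) →-dec
                       (TwoConnected? (Subset._∈? T) →-dec (all? λ x → x Subset.∈? T →-dec x Subset.∈? B)))

Connected-mono : {S : VPred {n}} {E E′ : EPred {n}} → (∀ {x y} → S x → S y → E x y → E′ x y) →
                 Connected S E → Connected S E′
Connected-mono E⇒E′ connected x y sx sy = Reach-map (λ sx → sx) E⇒E′ (connected x y sx sy)

TwoConnected-mono : {S : VPred {n}} {E E′ : EPred {n}} → (∀ {x y} → S x → S y → E x y → E′ x y) →
                    TwoConnected S E → TwoConnected S E′
TwoConnected-mono E⇒E′ (two , connected , robust) =
  two , Connected-mono E⇒E′ connected ,
  λ x sx → Connected-mono (λ (sa , _) (sb , _) → E⇒E′ sa sb) (robust x sx)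

TwoConnected-other : {S : VPred {n}} {E : EPred {n}} → TwoConnected S E → ∀ u → ∃ λ w → S w × w ≢ u
TwoConnected-other ((x , y , x≢y , sx , sy) , _) u with x ≟ u
... | yes refl = y , sy , x≢y ∘ sym
... | no  x≢u  = x , sx , x≢u

Connected-fromDeletion : {S : VPred {n}} {E : EPred {n}} → (∀ {x y} → E x y → E y x) →
                         ∀ {z w} → S z → S w → w ≢ z → E z w → Connected (S ∖ z) E → Connected S E
Connected-fromDeletion E-sym {z} {w} sz sw w≢z e connected x y sx sy with x ≟ z | y ≟ z
... | yes refl | yes refl = here sx
... | yes refl | no y≢z   = step sx e (Reach-∖⁻ (connected w y (sw , w≢z) (sy , y≢z)))
... | no x≢z   | yes refl = Reach-snoc (Reach-∖⁻ (connected x w (sx , x≢z) (sw , w≢z))) (E-sym e) sy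
... | no x≢z   | no y≢z   = Reach-∖⁻ (connected x y (sx , x≢z) (sy , y≢z))

module _ {n : ℕ} (G : Graph n) where

  Edge-irrefl : ∀ {x} → ¬ Edge G x x
  Edge-irrefl {x} e with trans (sym e) (Graph.irrefl G x)
  ... | ()

  Edge-sym : ∀ {x y} → Edge G x y → Edge G y x
  Edge-sym {x} {y} e = trans (Graph.sym G y x) e

  Edge? : ∀ x y → Dec (Edge G x y)
  Edge? x y = Graph.adj G x y ≟ᵇ true

  module CliqueWithPath {K : Subset n} (K-clique : ∀ {x y} → x ∈ K → y ∈ K → x ≢ y → Edge G x y)
                        {a b : Fin n} (a∈K : a ∈ K) (b∈K : b ∈ K) (a≢b : a ≢ b)
                        {E : EPred {n}} (E⇒Edge : ∀ {x y} → E x y → Edge G x y)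
                        {W : Reach (AllV G) E a b} (W-simple : Simple W) where

    K∪W? : Decidable λ x → x ∈ K ⊎ x ∈ₗ vertices W
    K∪W? x = x Subset.∈? K ⊎-dec ∈ₗ? _≟_ x (vertices W)

    T : Subset n
    T = subsetOf K∪W?

    K⊆T : ∀ {x} → x ∈ K → x ∈ T
    K⊆T x∈K = ∈-subsetOf⁺ K∪W? (inj₁ x∈K)

    W⊆T : ∀ {x} → x ∈ₗ vertices W → x ∈ T
    W⊆T x∈W = ∈-subsetOf⁺ K∪W? (inj₂ x∈W)

    module WithoutVertex (z : Fin n) where

      Tz : VPred {n}
      Tz = (_∈ T) ∖ z

      hub : ∃ λ h → h ∈ K × h ≢ z
      hub with a ≟ z
      ... | yes refl = b , b∈K , a≢b ∘ sym
      ... | no a≢z   = a , a∈K , a≢z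

      via-K : ∀ {x c} → c ∈ K → Reach Tz (Edge G) x c → Reach Tz (Edge G) x (proj₁ hub)
      via-K {c = c} c∈K r with c ≟ proj₁ hub
      ... | yes refl = r
      ... | no c≢h   = let (_ , h∈K , h≢z) = hub in Reach-snoc r (K-clique c∈K h∈K c≢h) (K⊆T h∈K , h≢z)

      along-W : ∀ {x y} → Reach ((_∈ₗ vertices W) ∖ z) E x y → Reach Tz (Edge G) x y
      along-W = Reach-map (λ (x∈W , x≢z) → W⊆T x∈W , x≢z) (λ _ _ → E⇒Edge)

      to-hub : ∀ {x} → Tz x → Reach Tz (Edge G) x (proj₁ hub)
      to-hub {x} (x∈T , x≢z) with ∈-subsetOf⁻ K∪W? x∈T
      ... | inj₁ x∈K = via-K x∈K (here (x∈T , x≢z))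
      ... | inj₂ x∈W with simple-split W W-simple x∈W x≢z
      ...   | inj₁ x↝b = via-K b∈K (along-W x↝b)
      ...   | inj₂ a↝x = via-K a∈K (Reach-reverse Edge-sym (along-W a↝x))

      connected : Connected Tz (Edge G)
      connected x y tx ty = Reach-trans (to-hub tx) (Reach-reverse Edge-sym (to-hub ty))

    T-twoConnected : TwoConnected (_∈ T) (Edge G)
    T-twoConnected =
      (a , b , a≢b , K⊆T a∈K , K⊆T b∈K) ,
      Connected-fromDeletion Edge-sym (K⊆T a∈K) (K⊆T b∈K) (a≢b ∘ sym) (K-clique a∈K b∈K a≢b)
                             (WithoutVertex.connected a) ,
      λ z _ → WithoutVertex.connected z

  EP-into : ∀ {B u x} → EP G ⟨ B , u ⟩ᵦ x u → x ∈ B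
  EP-into {B} {x = x} (_ , allowed) with x Subset.∈? B
  ... | yes x∈B = x∈B
  ... | no  x∉B = ⊥-elim (allowed (inj₂ (refl , x∉B)))

  EP-out : ∀ {B u y} → EP G ⟨ B , u ⟩ᵦ u y → y ∈ B
  EP-out {B} {y = y} (_ , allowed) with y Subset.∈? B
  ... | yes y∈B = y∈B
  ... | no  y∉B = ⊥-elim (allowed (inj₁ (refl , y∉B)))

  EP? : (p : Pair G) → ∀ x y → Dec (EP G p x y)
  EP? ⟨ u , B ⟩ᵥ x y =
    Edge? x y ×-dec ¬? ((x ≟ u ×-dec y Subset.∈? B) ⊎-dec (y ≟ u ×-dec x Subset.∈? B))
  EP? ⟨ B , u ⟩ᵦ x y =
    Edge? x y ×-dec ¬? ((x ≟ u ×-dec ¬? (y Subset.∈? B)) ⊎-dec (y ≟ u ×-dec ¬? (x Subset.∈? B)))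

  opaque
    VP? : (p : Pair G) → Decidable (VP G p)
    VP? p = Reach? (EP? p) (λ _ → yes tt) (base G p)

    Kappa? : ∀ B u → Decidable (Kappa G B u)
    Kappa? B u v = v Subset.∈? B ×-dec CutVertex? (EP? ⟨ B , u ⟩ᵦ) (VP? ⟨ B , u ⟩ᵦ) v

    BIsKappaU? : ∀ B u → Dec (BIsKappaU G B u)
    BIsKappaU? B u = all? λ x → (x Subset.∈? B →-dec (Kappa? B u x ⊎-dec x ≟ u)) ×-dec
                                ((Kappa? B u x ⊎-dec x ≟ u) →-dec x Subset.∈? B)

    Beta? : ∀ u B → Decidable (Beta G u B)
    Beta? u B B′ = IsBlock? (EP? ⟨ u , B ⟩ᵥ) (VP? ⟨ u , B ⟩ᵥ) B′ ×-dec u Subset.∈? B′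

-- Blocks of a block graph

module BlockGraph {n : ℕ} (G : Graph n) (isBlockGraph : IsBlockGraph G) where

  clique : ∀ {B x y} → IsBlockG G B → x ∈ B → y ∈ B → x ≢ y → Edge G x y
  clique blk = isBlockGraph _ blk _ _

  blockmate-unreachable : ∀ {B a b} → IsBlockG G B → a ∈ B → b ∈ B → a ≢ b → ¬ VP G ⟨ a , B ⟩ᵥ b
  blockmate-unreachable {B} blk a∈B b∈B a≢b r with eraseLoops r
  ... | here _ , _ = a≢b refl
  ... | walk@(step _ e W) , simple = proj₂ e (inj₁ (refl , x₁∈B))
    where
    open CliqueWithPath G (clique blk) a∈B b∈B a≢b proj₁ {walk} simple
    x₁∈B : _ ∈ B
    x₁∈B = proj₂ (proj₂ blk) T (λ _ → K⊆T) (λ _ _ → tt) T-twoConnected _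
                             (W⊆T (there (source∈vertices W)))

  module _ {B : Subset n} (blk : IsBlockG G B) {u : Fin n} (u∈B : u ∈ B) where

    private
      V = VP G ⟨ B , u ⟩ᵦ
      E = EP G ⟨ B , u ⟩ᵦ

    bypass-base : ∀ {x y} → Reach V E x y → x ≢ u → y ≢ u → Reach (V ∖ u) E x y
    bypass-base (here vx) x≢u _ = here (vx , x≢u)
    bypass-base {x} {y} (step {y = x′} vx e r) x≢u y≢u with x′ ≟ u
    ... | no x′≢u  = step (vx , x≢u) e (bypass-base r x′≢u y≢u)
    ... | yes refl = detour r
      where
      detour : Reach V E u y → Reach (V ∖ u) E x y
      detour (here _) = ⊥-elim (y≢u refl)
      detour (step {y = x″} _ e′ r′) with x″ ≟ x
      ... | yes refl = bypass-base r′ x≢u y≢u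
      ... | no x″≢x  = step (vx , x≢u) shortcut (bypass-base r′ x″≢u y≢u)
        where
        x″≢u : x″ ≢ u
        x″≢u refl = Edge-irrefl G (proj₁ e′)
        shortcut : E x x″
        shortcut = clique blk (EP-into G e) (EP-out G e′) (x″≢x ∘ sym) ,
                   Sum.[ x≢u ∘ proj₁ , x″≢u ∘ proj₁ ]

    ¬Kappa-base : ¬ Kappa G B u u
    ¬Kappa-base (_ , _ , x , y , x≢u , y≢u , _ , _ , r , ¬r) = ¬r (bypass-base r x≢u y≢u)

    module _ {v : Fin n} (v∈B : v ∈ B) (u≢v : u ≢ v) where

      base∉V[v,B] : ¬ VP G ⟨ v , B ⟩ᵥ u
      base∉V[v,B] = blockmate-unreachable blk v∈B u∈B (u≢v ∘ sym)

      V[v,B]⊆V[B,u] : ∀ {x} → VP G ⟨ v , B ⟩ᵥ x → VP G ⟨ B , u ⟩ᵦ x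
      V[v,B]⊆V[B,u] r =
        step tt (clique blk u∈B v∈B u≢v , Sum.[ (λ (_ , v∉B) → v∉B v∈B) , (λ (_ , u∉B) → u∉B u∈B) ])
                (Reach-mapFrom avoids-u r)
        where
        avoids-u : ∀ {w w′} → VP G ⟨ v , B ⟩ᵥ w → EP G ⟨ v , B ⟩ᵥ w w′ → E w w′
        avoids-u v↝w e = proj₁ e ,
          Sum.[ (λ (w≡u , _)  → base∉V[v,B] (subst (VP G ⟨ v , B ⟩ᵥ) w≡u v↝w))
              , (λ (w′≡u , _) → base∉V[v,B] (subst (VP G ⟨ v , B ⟩ᵥ) w′≡u (Reach-snoc v↝w e tt))) ]

  module _ {B : Subset n} (blk : IsBlockG G B) {u : Fin n} (u∈B : u ∈ B) where

    private
      V = VP G ⟨ u , B ⟩ᵥ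
      E = EP G ⟨ u , B ⟩ᵥ

    Edge⇒EP[u,B] : ∀ {a b} → (a ≡ u → b ∈ B → b ≡ u) → (b ≡ u → a ∈ B → a ≡ u) → Edge G a b → E a b
    Edge⇒EP[u,B] a≡u⇒ b≡u⇒ edge = edge ,
      Sum.[ (λ (a≡u , b∈B) → Edge-irrefl G (subst₂ (Edge G) a≡u (a≡u⇒ a≡u b∈B) edge))
          , (λ (b≡u , a∈B) → Edge-irrefl G (subst₂ (Edge G) (b≡u⇒ b≡u a∈B) b≡u edge)) ]

    module _ {B′ : Subset n} (β : Beta G u B B′) where

      private
        B′⊆V : ∀ x → x ∈ B′ → V x
        B′⊆V = proj₁ (proj₁ β)

        B′-twoConnected : TwoConnected (_∈ B′) E
        B′-twoConnected = proj₁ (proj₂ (proj₁ β))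

        B′-maximal : ∀ T → (∀ x → x ∈ B′ → x ∈ T) → (∀ x → x ∈ T → V x) →
                     TwoConnected (_∈ T) E → ∀ x → x ∈ T → x ∈ B′
        B′-maximal = proj₂ (proj₂ (proj₁ β))

      β∩B⊆base : ∀ {t} → t ∈ B′ → t ∈ B → t ≡ u
      β∩B⊆base {t} t∈B′ t∈B = decidable-stable (t ≟ u) λ t≢u →
        blockmate-unreachable blk u∈B t∈B (t≢u ∘ sym) (B′⊆V t t∈B′)

      V[B′,u]⊆V[u,B] : ∀ {x} → VP G ⟨ B′ , u ⟩ᵦ x → V x
      V[B′,u]⊆V[u,B] = Reach-map (λ _ → tt) λ _ _ e →
        Edge⇒EP[u,B] (λ { refl → β∩B⊆base (EP-out G e) }) (λ { refl → β∩B⊆base (EP-into G e) }) (proj₁ e)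

      β-isBlock : IsBlockG G B′
      β-isBlock = (λ _ _ → tt) , TwoConnected-mono (λ _ _ → proj₁) B′-twoConnected , maximal
        where
        maximal : ∀ T → (∀ x → x ∈ B′ → x ∈ T) → (∀ x → x ∈ T → AllV G x) →
                  TwoConnected (_∈ T) (Edge G) → ∀ x → x ∈ T → x ∈ B′
        maximal T B′⊆T _ T-twoConnected = B′-maximal T B′⊆T T⊆V T-twoConnectedᵤ
          where
          u∈T : u ∈ T
          u∈T = B′⊆T u (proj₂ β)

          T∩B⊆base : ∀ {t} → t ∈ T → t ∈ B → t ≡ u
          T∩B⊆base {t} t∈T t∈B = decidable-stable (t ≟ u) λ t≢u →
            let (w , w∈B′ , w≢u) = TwoConnected-other B′-twoConnected u
                w↝t = proj₂ (proj₂ T-twoConnected) u u∈T w t (B′⊆T w w∈B′ , w≢u) (t∈T , t≢u)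
            in blockmate-unreachable blk u∈B t∈B (t≢u ∘ sym) (Reach-trans (B′⊆V w w∈B′) (avoiding-u w↝t))
            where
            avoiding-u : ∀ {x y} → Reach ((_∈ T) ∖ u) (Edge G) x y → Reach (AllV G) E x y
            avoiding-u = Reach-map (λ _ → tt) λ (_ , a≢u) (_ , b≢u) e →
                           e , Sum.[ a≢u ∘ proj₁ , b≢u ∘ proj₁ ]

          T-twoConnectedᵤ : TwoConnected (_∈ T) E
          T-twoConnectedᵤ =
            TwoConnected-mono (λ a∈T b∈T → Edge⇒EP[u,B] (λ _ → T∩B⊆base b∈T) (λ _ → T∩B⊆base a∈T))
                              T-twoConnected

          T⊆V : ∀ x → x ∈ T → V x
          T⊆V x x∈T = Reach-map (λ _ → tt) (λ _ _ e → e) (proj₁ (proj₂ T-twoConnectedᵤ) u x u∈T x∈T)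

0≤toℤ : ∀ b → 0ℤ ≤ toℤ b
0≤toℤ true  = +≤+ z≤n
0≤toℤ false = +≤+ z≤n

0≤i+toℤ : ∀ {i} b → 0ℤ ≤ i → 0ℤ ≤ i + toℤ b
0≤i+toℤ b 0≤i = ℤ.+-mono-≤ 0≤i (0≤toℤ b)

0<i+toℤ : ∀ {i b} → 0ℤ ≤ i → b ≡ true → 0ℤ < i + toℤ b
0<i+toℤ 0≤i refl = ℤ.+-mono-≤-< 0≤i (+<+ (s≤s z≤n))

0<i⇒0≤i-m : ∀ {i m} → 0ℤ < i → m ≤ℕ 1 → 0ℤ ≤ i - + m
0<i⇒0≤i-m 0<i m≤1 = ℤ.i≤j⇒0≤j-i (ℤ.≤-trans (+≤+ m≤1) (ℤ.i<j⇒suc[i]≤j 0<i))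

0≤i-toℤ : ∀ {i} b → 0ℤ ≤ i → ¬ (i ≡ 0ℤ × b ≡ true) → 0ℤ ≤ i - toℤ b
0≤i-toℤ {i} false 0≤i _      = subst (0ℤ ≤_) (sym (ℤ.+-identityʳ i)) 0≤i
0≤i-toℤ     true  0≤i ¬i≡0∧b = 0<i⇒0≤i-m (ℤ.≤∧≢⇒< 0≤i λ 0≡i → ¬i≡0∧b (sym 0≡i , refl)) (s≤s z≤n)

module _ {A : Set} (f : A → ℤ) where

  sumℤ-nonneg : ∀ xs → (∀ {x} → x ∈ₗ xs → 0ℤ ≤ f x) → 0ℤ ≤ sumℤ (map f xs)
  sumℤ-nonneg []       _      = +≤+ z≤n
  sumℤ-nonneg (x ∷ xs) nonneg = ℤ.+-mono-≤ (nonneg (here refl)) (sumℤ-nonneg xs (nonneg ∘ there))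

  sumℤ-pos : ∀ xs → (∀ {x} → x ∈ₗ xs → 0ℤ ≤ f x) → ∀ {w} → w ∈ₗ xs → 0ℤ < f w → 0ℤ < sumℤ (map f xs)
  sumℤ-pos (x ∷ xs) nonneg (here refl) pos = ℤ.+-mono-<-≤ pos (sumℤ-nonneg xs (nonneg ∘ there))
  sumℤ-pos (x ∷ xs) nonneg (there w∈)  pos =
    ℤ.+-mono-≤-< (nonneg (here refl)) (sumℤ-pos xs (nonneg ∘ there) w∈ pos)

2a+1<2b : ∀ {a b} → a <ℕ b → suc (2 * a) <ℕ 2 * b
2a+1<2b {a} {b} a<b = subst (_≤ℕ 2 * b) (*-suc 2 a) (*-monoʳ-≤ 2 a<b)

-- The witness does not depend on the proof of A, so it can serve as a total function of the index.
decidedChoice : {A X : Set} {P : X → Set} → X → Dec A → (A → Σ X P) → Σ X λ x → A → P x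
decidedChoice _  (yes a) solve = proj₁ (solve a) , λ _ → proj₂ (solve a)
decidedChoice x₀ (no ¬a) _     = x₀ , λ a → ⊥-elim (¬a a)

-- Capacity

module Capacity {n : ℕ} (G : Graph n) (isBlockGraph : IsBlockGraph G) where

  open BlockGraph G isBlockGraph

  V[_] : Pair G → Subset n
  V[ p ] = subsetOf (VP? G p)

  ∈V⁺ : ∀ p {x} → VP G p x → x ∈ V[ p ]
  ∈V⁺ p = ∈-subsetOf⁺ (VP? G p)

  ∈V⁻ : ∀ p {x} → x ∈ V[ p ] → VP G p x
  ∈V⁻ p = ∈-subsetOf⁻ (VP? G p)

  -- (u,B) weighs one more than (B,u): the step from (u,B) to (B′,u) need not shrink the vertex set.
  size : Pair G → ℕ
  size ⟨ u , B ⟩ᵥ = suc (2 * ∣ V[ ⟨ u , B ⟩ᵥ ] ∣)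
  size ⟨ B , u ⟩ᵦ = 2 * ∣ V[ ⟨ B , u ⟩ᵦ ] ∣

  WellFormed : Pair G → Set
  WellFormed ⟨ u , B ⟩ᵥ = IsBlockG G B × u ∈ B
  WellFormed ⟨ B , u ⟩ᵦ = IsBlockG G B × u ∈ B

  record Bounds (p : Pair G) (C : Subset n) (c : ℤ) (b : Bool) : Set where
    field
      isCap : Cap G p C c
      isUA  : UA G p b
      cap≥0 : 0ℤ ≤ c
      cap>0 : b ≡ true → ¬ UnderAttack G (base G p) C → 0ℤ < c

  Solution : Pair G → Subset n → Set
  Solution p C = Σ ℤ λ c → Σ Bool λ b → Bounds p C c b

  record PartBounds (q : Pair G) (C : Subset n) (c : ℤ) (b : Bool) : Set where
    field
      part   : Subset n
      restr  : Restr G C q part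
      bounds : Bounds q part c b
    open Bounds bounds public

    part⊆C : ∀ {x} → x ∈ part → x ∈ C
    part⊆C {x} x∈ = proj₁ (proj₁ (restr x) x∈)

    attacked-in-whole : ∀ {w} → UnderAttack G w part → UnderAttack G w C
    attacked-in-whole (x , x∈ , edge) = x , part⊆C x∈ , edge

  PartSolution : Pair G → Subset n → Set
  PartSolution q C = Σ (ℤ × Bool) (uncurry (PartBounds q C))

  restrict : ∀ C q → Restr G C q (C ∩ V[ q ])
  restrict C q x = (λ x∈ → let (x∈C , x∈V) = x∈p∩q⁻ C V[ q ] x∈ in x∈C , ∈-subsetOf⁻ (VP? G q) x∈V)
                 , (λ (x∈C , vx) → x∈p∩q⁺ (x∈C , ∈-subsetOf⁺ (VP? G q) vx))

  Independent : Subset n → Set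
  Independent C = ∀ x y → x ∈ C → y ∈ C → ¬ Edge G x y

  Restr-indep : ∀ {q C D} → Independent C → Restr G C q D → PIndep G q D
  Restr-indep indep restr =
    (λ x x∈D → proj₂ (proj₁ (restr x) x∈D)) ,
    (λ x y x∈D y∈D → indep x y (proj₁ (proj₁ (restr x) x∈D)) (proj₁ (proj₁ (restr y) y∈D)))

  Motive : Pair G → Set
  Motive p = WellFormed p → ∀ C → PIndep G p C → Solution p C

  solvePart : ∀ {q C} → Motive q → WellFormed q → Independent C → PartSolution q C
  solvePart {q = q} {C} solve wf indep =
    let (c , b , bounds) = solve wf (C ∩ V[ q ]) (Restr-indep indep (restrict C q))
    in (c , b) , record { part = C ∩ V[ q ] ; restr = restrict C q ; bounds = bounds }

  module Bu {B : Subset n} {u : Fin n} (blk : IsBlockG G B) (u∈B : u ∈ B)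
            (rec : WfRec (_<ℕ_ on size) Motive ⟨ B , u ⟩ᵦ)
            {C : Subset n} (indep : PIndep G ⟨ B , u ⟩ᵦ C) where

    κ-smaller : ∀ {v} → Kappa G B u v → size ⟨ v , B ⟩ᵥ <ℕ size ⟨ B , u ⟩ᵦ
    κ-smaller {v} κ = 2a+1<2b (p⊂q⇒∣p∣<∣q∣ (V[v]⊆V[u] , u , ∈V⁺ ⟨ B , u ⟩ᵦ (here tt) ,
                                            base∉V[v,B] blk u∈B (proj₁ κ) u≢v ∘ ∈V⁻ ⟨ v , B ⟩ᵥ))
      where
      u≢v : u ≢ v
      u≢v refl = ¬Kappa-base blk u∈B κ
      V[v]⊆V[u] : V[ ⟨ v , B ⟩ᵥ ] ⊆ V[ ⟨ B , u ⟩ᵦ ]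
      V[v]⊆V[u] = ∈V⁺ ⟨ B , u ⟩ᵦ ∘ V[v,B]⊆V[B,u] blk u∈B (proj₁ κ) u≢v ∘ ∈V⁻ ⟨ v , B ⟩ᵥ

    opaque
      child : ∀ v → Σ (ℤ × Bool) λ cb → Kappa G B u v → uncurry (PartBounds ⟨ v , B ⟩ᵥ C) cb
      child v = decidedChoice (0ℤ , true) (Kappa? G B u v) λ κ →
                  solvePart (rec (κ-smaller κ)) (blk , proj₁ κ) (proj₂ indep)

      f : Fin n → ℤ
      f v = proj₁ (proj₁ (child v))

      g : Fin n → Bool
      g v = proj₂ (proj₁ (child v))

      childBounds : ∀ {v} → Kappa G B u v → PartBounds ⟨ v , B ⟩ᵥ C (f v) (g v)
      childBounds {v} = proj₂ (child v)

    ks : List (Fin n)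
    ks = proj₁ (enumerate-Fin (Kappa? G B u))

    ks-enum : Enum (Kappa G B u) ks
    ks-enum = proj₂ (enumerate-Fin (Kappa? G B u))

    sum : ℤ
    sum = sumℤ (map f ks)

    f≥0 : ∀ {v} → v ∈ₗ ks → 0ℤ ≤ f v
    f≥0 v∈ = PartBounds.cap≥0 (childBounds (proj₁ (proj₂ ks-enum) _ v∈))

    sum≥0 : 0ℤ ≤ sum
    sum≥0 = sumℤ-nonneg f ks f≥0

    ua : Σ Bool λ b → UA G ⟨ B , u ⟩ᵦ b ×
                      (b ≡ false → ∀ {w} → w ∈ B → w ≢ u → Kappa G B u w × g w ≡ true)
    ua with any? (Kappa? G B u)
    ... | no none = true , bu-leaf (λ v κ → none (v , κ)) , λ ()
    ... | yes some with any? (λ v → Kappa? G B u v ×-dec (g v ≟ᵇ false))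
    ...   | yes (v , κ , gv≡false) =
            true , bu-true₁ some (v , κ , subst (UA G _) gv≡false (PartBounds.isUA (childBounds κ))) ,
            λ ()
    ...   | no ¬false with BIsKappaU? G B u
    ...     | no ¬tight = true , bu-true₂ some ¬tight , λ ()
    ...     | yes tight =
              false ,
              bu-false some (λ v κ → subst (UA G _) (g≡true κ) (PartBounds.isUA (childBounds κ))) tight ,
              λ _ w∈B w≢u → let κ = kappa w∈B w≢u in κ , g≡true κ
      where
      g≡true : ∀ {v} → Kappa G B u v → g v ≡ true
      g≡true κ = ¬-not λ gv≡false → ¬false (_ , κ , gv≡false)
      kappa : ∀ {w} → w ∈ B → w ≢ u → Kappa G B u w
      kappa w∈B w≢u with proj₁ (tight _) w∈B
      ... | inj₁ κ    = κ
      ... | inj₂ w≡u = ⊥-elim (w≢u w≡u)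

    b : Bool
    b = proj₁ ua

    m : ℕ
    m = ∣ B ∩ (C ∖ˢ u) ∣

    module CMeetsB {w : Fin n} (w∈ : w ∈ B ∩ (C ∖ˢ u)) where

      w∈B : w ∈ B
      w∈B = proj₁ (x∈p∩q-y⁻ B C w∈)

      w∈C : w ∈ C
      w∈C = proj₁ (proj₂ (x∈p∩q-y⁻ B C w∈))

      w≢u : w ≢ u
      w≢u = proj₂ (proj₂ (x∈p∩q-y⁻ B C w∈))

      base-attacked : UnderAttack G u C
      base-attacked = w , w∈C , clique blk u∈B w∈B (w≢u ∘ sym)

      m≤1 : m ≤ℕ 1
      m≤1 = ∣p∣≤1 {p = B ∩ (C ∖ˢ u)} λ {x} x∈ → let (x∈B , x∈C , _) = x∈p∩q-y⁻ B C x∈ in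
        decidable-stable (x ≟ w) λ x≢w → proj₂ indep x w x∈C w∈C (clique blk x∈B w∈B x≢w)

      sum+b>0 : 0ℤ < sum + toℤ b
      sum+b>0 with b in b≡
      ... | true  = 0<i+toℤ sum≥0 refl
      ... | false = ℤ.+-mono-<-≤ (sumℤ-pos f ks f≥0 (proj₂ (proj₂ ks-enum) w κ) f>0) (+≤+ z≤n)
        where
        κ : Kappa G B u w
        κ = proj₁ (proj₂ (proj₂ ua) b≡ w∈B w≢u)
        f>0 : 0ℤ < f w
        f>0 = PartBounds.cap>0 (childBounds κ) (proj₂ (proj₂ (proj₂ ua) b≡ w∈B w≢u))
                λ (x , x∈D , edge) → proj₂ indep w x w∈C (PartBounds.part⊆C (childBounds κ) x∈D) edge

    crowded-or-m≡0 : ∃ (_∈ B ∩ (C ∖ˢ u)) ⊎ m ≡ 0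
    crowded-or-m≡0 with nonempty? (B ∩ (C ∖ˢ u))
    ... | yes crowded = inj₁ crowded
    ... | no  empty   = inj₂ (∣p∣≡0 empty)

    cap≥0 : 0ℤ ≤ sum + toℤ b - + m
    cap≥0 with crowded-or-m≡0
    ... | inj₁ (_ , w∈) = 0<i⇒0≤i-m (CMeetsB.sum+b>0 w∈) (CMeetsB.m≤1 w∈)
    ... | inj₂ m≡0 rewrite m≡0 | ℤ.+-identityʳ (sum + toℤ b) = 0≤i+toℤ b sum≥0

    cap>0 : b ≡ true → ¬ UnderAttack G u C → 0ℤ < sum + toℤ b - + m
    cap>0 b≡true free with crowded-or-m≡0
    ... | inj₁ (_ , w∈) = ⊥-elim (free (CMeetsB.base-attacked w∈))
    ... | inj₂ m≡0 rewrite m≡0 | ℤ.+-identityʳ (sum + toℤ b) = 0<i+toℤ sum≥0 b≡true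

    solution : Solution ⟨ B , u ⟩ᵦ C
    solution = sum + toℤ b - + m , b , record
      { isCap = cap-bu ks ks-enum f children b (proj₁ (proj₂ ua))
      ; isUA  = proj₁ (proj₂ ua)
      ; cap≥0 = cap≥0
      ; cap>0 = cap>0
      }
      where
      children : ∀ v → v ∈ₗ ks → Σ (Subset n) λ D → Restr G C ⟨ v , B ⟩ᵥ D × Cap G ⟨ v , B ⟩ᵥ D (f v)
      children v v∈ = let open PartBounds (childBounds (proj₁ (proj₂ ks-enum) v v∈))
                      in part , restr , isCap

  module uB {u : Fin n} {B : Subset n} (blk : IsBlockG G B) (u∈B : u ∈ B)
            (rec : WfRec (_<ℕ_ on size) Motive ⟨ u , B ⟩ᵥ)
            {C : Subset n} (indep : PIndep G ⟨ u , B ⟩ᵥ C) where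

    β-smaller : ∀ {B′} → Beta G u B B′ → size ⟨ B′ , u ⟩ᵦ <ℕ size ⟨ u , B ⟩ᵥ
    β-smaller {B′} β = s≤s (*-monoʳ-≤ 2 (p⊆q⇒∣p∣≤∣q∣ V[B′]⊆V[u]))
      where
      V[B′]⊆V[u] : V[ ⟨ B′ , u ⟩ᵦ ] ⊆ V[ ⟨ u , B ⟩ᵥ ]
      V[B′]⊆V[u] = ∈V⁺ ⟨ u , B ⟩ᵥ ∘ V[B′,u]⊆V[u,B] blk u∈B β ∘ ∈V⁻ ⟨ B′ , u ⟩ᵦ

    opaque
      child : ∀ B′ → Σ (ℤ × Bool) λ cb → Beta G u B B′ → uncurry (PartBounds ⟨ B′ , u ⟩ᵦ C) cb
      child B′ = decidedChoice (0ℤ , true) (Beta? G u B B′) λ β →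
                   solvePart (rec (β-smaller β)) (β-isBlock blk u∈B β , proj₂ β) (proj₂ indep)

      f : Subset n → ℤ
      f B′ = proj₁ (proj₁ (child B′))

      g : Subset n → Bool
      g B′ = proj₂ (proj₁ (child B′))

      childBounds : ∀ {B′} → Beta G u B B′ → PartBounds ⟨ B′ , u ⟩ᵦ C (f B′) (g B′)
      childBounds {B′} = proj₂ (child B′)

    bs : List (Subset n)
    bs = proj₁ (enumerate-Subset (Beta? G u B))

    bs-enum : Enum (Beta G u B) bs
    bs-enum = proj₂ (enumerate-Subset (Beta? G u B))

    bs⇒β : ∀ {B′} → B′ ∈ₗ bs → Beta G u B B′
    bs⇒β = proj₁ (proj₂ bs-enum) _

    ua : Σ Bool (UA G ⟨ u , B ⟩ᵥ)
    ua with Any.any? (λ B′ → g B′ ≟ᵇ true) bs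
    ... | yes some = let (B′ , B′∈ , gB′≡true) = find some in
                     true , ub-true (B′ , bs⇒β B′∈ ,
                                     subst (UA G _) gB′≡true (PartBounds.isUA (childBounds (bs⇒β B′∈))))
    ... | no none  = false , ub-false λ B′ β →
                       subst (UA G _) (¬-not λ gB′≡true → none (lose (proj₂ (proj₂ bs-enum) B′ β) gB′≡true))
                             (PartBounds.isUA (childBounds β))

    b : Bool
    b = proj₁ ua

    Exhausted : Subset n → Set
    Exhausted B′ = f B′ ≡ 0ℤ × g B′ ≡ true

    term : Subset n → ℤ
    term B′ = f B′ - toℤ (g B′)

    exhausted-solution : ∀ {B′} → B′ ∈ₗ bs → Exhausted B′ → Solution ⟨ u , B ⟩ᵥ C
    exhausted-solution {B′} B′∈ (f≡0 , g≡true) = 0ℤ , true , record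
      { isCap = cap-ub-zero B′ β part restr (subst (Cap G _ part) f≡0 isCap) uaᵦ
      ; isUA  = ub-true (B′ , β , uaᵦ)
      ; cap≥0 = +≤+ z≤n
      ; cap>0 = λ _ free →
                  ⊥-elim (ℤ.<-irrefl refl (subst (0ℤ <_) f≡0 (cap>0 g≡true (free ∘ attacked-in-whole))))
      }
      where
      β : Beta G u B B′
      β = bs⇒β B′∈
      open PartBounds (childBounds β)
      uaᵦ : UA G ⟨ B′ , u ⟩ᵦ true
      uaᵦ = subst (UA G _) g≡true isUA

    sum-solution : (∀ {B′} → B′ ∈ₗ bs → ¬ Exhausted B′) → Solution ⟨ u , B ⟩ᵥ C
    sum-solution none = sum + toℤ b , b , record
      { isCap = cap-ub-sum bs bs-enum f g children (λ _ → none) b (proj₂ ua)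
      ; isUA  = proj₂ ua
      ; cap≥0 = 0≤i+toℤ b sum≥0
      ; cap>0 = λ b≡true _ → 0<i+toℤ sum≥0 b≡true
      }
      where
      sum : ℤ
      sum = sumℤ (map term bs)
      sum≥0 : 0ℤ ≤ sum
      sum≥0 = sumℤ-nonneg term bs λ B′∈ →
                0≤i-toℤ (g _) (PartBounds.cap≥0 (childBounds (bs⇒β B′∈))) (none B′∈)
      children : ∀ B′ → B′ ∈ₗ bs → Σ (Subset n) λ D → Restr G C ⟨ B′ , u ⟩ᵦ D ×
                                     Cap G ⟨ B′ , u ⟩ᵦ D (f B′) × UA G ⟨ B′ , u ⟩ᵦ (g B′)
      children B′ B′∈ = let open PartBounds (childBounds (bs⇒β B′∈)) in part , restr , isCap , isUA

    solution : Solution ⟨ u , B ⟩ᵥ C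
    solution with Any.any? (λ B′ → (f B′ ℤ.≟ 0ℤ) ×-dec (g B′ ≟ᵇ true)) bs
    ... | yes some = let (_ , B′∈ , exhausted) = find some in exhausted-solution B′∈ exhausted
    ... | no none  = sum-solution λ B′∈ exhausted → none (lose B′∈ exhausted)

  solve : ∀ p → Motive p
  solve = WF.All.wfRec (On.wellFounded size <-wellFounded) 0ℓ Motive solveFrom
    where
    solveFrom : ∀ p → WfRec (_<ℕ_ on size) Motive p → Motive p
    solveFrom ⟨ u , B ⟩ᵥ rec (blk , u∈B) C indep = uB.solution blk u∈B rec indep
    solveFrom ⟨ B , u ⟩ᵦ rec (blk , u∈B) C indep = Bu.solution blk u∈B rec indep

  claims : ∀ {p C} → Solution p C →
           Σ ℤ λ c → Σ Bool λ b → Cap G p C c × UA G p b ×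
             (0ℤ ≤ c) × (b ≡ true → ¬ UnderAttack G (base G p) C → 0ℤ < c)
  claims (c , b , bounds) = c , b , isCap , isUA , cap≥0 , cap>0
    where open Bounds bounds

lemma4p1 : ∀ {n} (G : Graph n) → IsConnected G → IsBlockGraph G →
    (u : Fin n) (B : Subset n) → IsCutVertex G u → IsBlockG G B → u ∈ B →
    (p : Pair G) → (p ≡ ⟨ u , B ⟩ᵥ ⊎ p ≡ ⟨ B , u ⟩ᵦ) →
    (C : Subset n) → PIndep G p C →
    Σ ℤ λ c → Σ Bool λ b → Cap G p C c × UA G p b ×
      (0ℤ ≤ c) × (b ≡ true → ¬ UnderAttack G u C → 0ℤ < c)
lemma4p1 G _ isBlockGraph u B _ blk u∈B _ (inj₁ refl) C indep =
  Capacity.claims G isBlockGraph (Capacity.solve G isBlockGraph ⟨ u , B ⟩ᵥ (blk , u∈B) C indep)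
lemma4p1 G _ isBlockGraph u B _ blk u∈B _ (inj₂ refl) C indep =
  Capacity.claims G isBlockGraph (Capacity.solve G isBlockGraph ⟨ B , u ⟩ᵦ (blk , u∈B) C indep)
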